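{- Let $(\vec\alpha_1,\vec w_1),\ldots,(\vec\alpha_k,\vec w_k)$ be AW selector-pairs, $(\vec\alpha_j,\vec w_j)$ over index set $I_j$, and let $(\vec\alpha,\vec w)=(\vec\alpha_1,\vec w_1)\circ\cdots\circ(\vec\alpha_k,\vec w_k)$. Then $M_{\vec\alpha,\vec w}=M_{\vec\alpha_1,\vec w_1}\cdots M_{\vec\alpha_k,\vec w_k}$.
   Context: An AW selector-pair over a finite set $I$ is $(\vec\alpha,\vec w)$ where $\vec\alpha=(\alpha^0,\alpha^1)$ with $\alpha^0,\alpha^1\in\{0,1\}^I$ and $\vec w=(w^0,w^1)$ with $w^0,w^1:I\to\mathbb{R}_{\ge0}$. Its profile matrix $M_{\vec\alpha,\vec w}$ is the $2\times2$ matrix with rows and columns indexed by $\{0,1\}$ whose $(s,t)$ entry is $\sum_{j\in I:\alpha^s_j=t}w^s(j)$. The composition $(\vec\alpha,\vec w)=(\vec\alpha_1,\vec w_1)\circ\cdots\circ(\vec\alpha_k,\vec w_k)$ is the AW selector-pair over $I_1\times\cdots\times I_k$ defined as follows: for $c\in\{0,1\}$ and $(i_1,\ldots,i_k)$, put $b_0=c$ and $b_j=\alpha_j^{b_{j-1}}(i_j)$ for $j=1,\ldots,k$; then $\alpha^c(i_1,\ldots,i_k)=b_k$ and $w^c(i_1,\ldots,i_k)=\prod_{j=1}^k w_j^{b_{j-1}}(i_j)$. -}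

module Defs where

open import Level using (Level)
open import Data.Bool using (Bool; true; false; if_then_else_)
open import Data.Bool.Properties using () renaming (_≟_ to _≟B_)
open import Data.Nat using (ℕ; zero; suc)
open import Data.Fin using (Fin)
import Data.Fin as F
open import Data.List using (List; []; _∷_)
open import Data.Product using (_×_; _,_)
open import Data.Unit.Polymorphic using (⊤; tt)
open import Relation.Nullary using (does)
open import Algebra.Bundles using (CommutativeSemiring)

-- Everything is parametrised by a commutative semiring R of weights
-- (the paper's case is the semiring of nonnegative reals ℝ≥0).
module AW {c ℓ : Level} (R : CommutativeSemiring c ℓ) where
  open CommutativeSemiring R

  -- An AW selector-pair over a type I: α s i ∈ {0,1}, w s i ∈ R  (s ∈ {0,1}).
  -- Bool encodes {0,1}: false = 0, true = 1.
  record SelPair (I : Set) : Set c where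
    constructor selPair
    field
      α : Bool → I → Bool
      w : Bool → I → Carrier
  open SelPair public

  Mat : Set c
  Mat = Bool → Bool → Carrier

  _·_ : Mat → Mat → Mat
  (A · B) s t = (A s false * B false t) + (A s true * B true t)

  sumFin : (n : ℕ) → (Fin n → Carrier) → Carrier
  sumFin zero    f = 0#
  sumFin (suc n) f = f F.zero + sumFin n (λ i → f (F.suc i))

  -- Profile matrix, given the summation operator of the finite index set I:
  -- M s t = Σ_{j ∈ I, α^s_j = t} w^s(j)
  profile : {I : Set} → ((I → Carrier) → Carrier) → SelPair I → Mat
  profile sumI p s t = sumI (λ j → if does (α p s j ≟B t) then w p s j else 0#)

  -- Finite index sets I_j = Fin n_j; the product I_1 × ⋯ × I_k
  Idx : List ℕ → Set
  Idx []       = ⊤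
  Idx (n ∷ ns) = Fin n × Idx ns

  sumIdx : (ns : List ℕ) → (Idx ns → Carrier) → Carrier
  sumIdx []       f = f tt
  sumIdx (n ∷ ns) f = sumFin n (λ i → sumIdx ns (λ t → f (i , t)))

  data Pairs : List ℕ → Set c where
    []  : Pairs []
    _∷_ : {n : ℕ} {ns : List ℕ} → SelPair (Fin n) → Pairs ns → Pairs (n ∷ ns)

  -- composition: b_0 = c, b_j = α_j^{b_{j-1}}(i_j); α^c = b_k,
  -- w^c = ∏_j w_j^{b_{j-1}}(i_j)
  compα : {ns : List ℕ} → Pairs ns → Bool → Idx ns → Bool
  compα []       b tt      = b
  compα (p ∷ ps) b (i , t) = compα ps (α p b i) t

  compw : {ns : List ℕ} → Pairs ns → Bool → Idx ns → Carrier
  compw []       b tt      = 1#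
  compw (p ∷ ps) b (i , t) = w p b i * compw ps (α p b i) t

  compose : {ns : List ℕ} → Pairs ns → SelPair (Idx ns)
  compose ps = selPair (compα ps) (compw ps)

  profileComp : {ns : List ℕ} → Pairs ns → Mat
  profileComp {ns} ps = profile (sumIdx ns) (compose ps)

  prodProfiles : {n : ℕ} {ns : List ℕ} → Pairs (n ∷ ns) → Mat
  prodProfiles {n} (p ∷ [])     = profile (sumFin n) p
  prodProfiles {n} (p ∷ q ∷ ps) = profile (sumFin n) p · prodProfiles (q ∷ ps)

module Submission where

open import Defs
open import Level using (Level)
open import Data.Bool using (Bool; true; false; if_then_else_)
open import Data.Bool.Properties using () renaming (_≟_ to _≟B_)
open import Relation.Nullary using (does)
open import Data.Nat using (ℕ; zero; suc)
open import Data.Fin using (Fin)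
import Data.Fin as F
open import Data.List using (List; []; _∷_)
open import Data.Product using (_,_)
open import Data.Unit.Polymorphic using (tt)
open import Algebra.Bundles using (CommutativeSemiring)
open import Relation.Binary.PropositionalEquality using (_≗_; cong; cong₂) renaming (refl to ≡-refl)
import Algebra.Properties.Semiring.Sum as SemiringSum
import Relation.Binary.Reasoning.Setoid as SetoidReasoning

-- Unfolding the composite one factor at a time, the first index i sends the row s
-- to the row α₁^s(i) of the remaining composite with weight w₁^s(i); grouping the
-- i by the value of α₁^s(i) ∈ {0,1} is exactly a row of M₁ times the profile of
-- the remaining composite.

module Composition {c ℓ : Level} (R : CommutativeSemiring c ℓ) where
  open CommutativeSemiring R
  open AW R
  open SemiringSum semiring using (sum; sum-cong-≋; ∑-distrib-+; *-distribˡ-sum; *-distribʳ-sum)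
  open SetoidReasoning setoid

  sumFin≗sum : (n : ℕ) → sumFin n ≗ sum
  sumFin≗sum zero    f = ≡-refl
  sumFin≗sum (suc n) f = cong (f F.zero +_) (sumFin≗sum n (λ i → f (F.suc i)))

  sumFin-cong : (n : ℕ) {f g : Fin n → Carrier} → (∀ i → f i ≈ g i) → sumFin n f ≈ sumFin n g
  sumFin-cong n {f} {g} f≈g = begin
    sumFin n f  ≡⟨ sumFin≗sum n f ⟩
    sum f       ≈⟨ sum-cong-≋ f≈g ⟩
    sum g       ≡⟨ sumFin≗sum n g ⟨
    sumFin n g  ∎

  sumFin-distrib-+ : (n : ℕ) (f g : Fin n → Carrier) →
                     sumFin n (λ i → f i + g i) ≈ sumFin n f + sumFin n g
  sumFin-distrib-+ n f g = begin
    sumFin n (λ i → f i + g i)  ≡⟨ sumFin≗sum n _ ⟩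
    sum (λ i → f i + g i)       ≈⟨ ∑-distrib-+ f g ⟩
    sum f + sum g               ≡⟨ cong₂ _+_ (sumFin≗sum n f) (sumFin≗sum n g) ⟨
    sumFin n f + sumFin n g     ∎

  *-distribˡ-sumFin : (n : ℕ) (x : Carrier) (f : Fin n → Carrier) →
                      x * sumFin n f ≈ sumFin n (λ i → x * f i)
  *-distribˡ-sumFin n x f = begin
    x * sumFin n f            ≡⟨ cong (x *_) (sumFin≗sum n f) ⟩
    x * sum f                 ≈⟨ *-distribˡ-sum x f ⟩
    sum (λ i → x * f i)       ≡⟨ sumFin≗sum n _ ⟨
    sumFin n (λ i → x * f i)  ∎

  *-distribʳ-sumFin : (n : ℕ) (x : Carrier) (f : Fin n → Carrier) →
                      sumFin n f * x ≈ sumFin n (λ i → f i * x)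
  *-distribʳ-sumFin n x f = begin
    sumFin n f * x            ≡⟨ cong (_* x) (sumFin≗sum n f) ⟩
    sum f * x                 ≈⟨ *-distribʳ-sum x f ⟩
    sum (λ i → f i * x)       ≡⟨ sumFin≗sum n _ ⟨
    sumFin n (λ i → f i * x)  ∎

  sumIdx-cong : (ns : List ℕ) {f g : Idx ns → Carrier} → (∀ i → f i ≈ g i) → sumIdx ns f ≈ sumIdx ns g
  sumIdx-cong []       f≈g = f≈g tt
  sumIdx-cong (n ∷ ns) f≈g = sumFin-cong n (λ i → sumIdx-cong ns (λ t → f≈g (i , t)))

  *-distribˡ-sumIdx : (ns : List ℕ) (x : Carrier) (f : Idx ns → Carrier) →
                      x * sumIdx ns f ≈ sumIdx ns (λ i → x * f i)
  *-distribˡ-sumIdx []       x f = refl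
  *-distribˡ-sumIdx (n ∷ ns) x f =
    trans (*-distribˡ-sumFin n x _) (sumFin-cong n (λ i → *-distribˡ-sumIdx ns x _))

  if-*ˡ : (b : Bool) (x y : Carrier) → (if b then x * y else 0#) ≈ x * (if b then y else 0#)
  if-*ˡ true  x y = refl
  if-*ˡ false x y = sym (zeroʳ x)

  if-*-identityʳ : (b : Bool) (x : Carrier) → (if b then x * 1# else 0#) ≈ (if b then x else 0#)
  if-*-identityʳ true  x = *-identityʳ x
  if-*-identityʳ false x = refl

  *-split-on-Bool : (b : Bool) (x : Carrier) (g : Bool → Carrier) →
    x * g b ≈ (if does (b ≟B false) then x else 0#) * g false
            + (if does (b ≟B true)  then x else 0#) * g true
  *-split-on-Bool false x g = sym (trans (+-congˡ (zeroˡ _)) (+-identityʳ _))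
  *-split-on-Bool true  x g = sym (trans (+-congʳ (zeroˡ _)) (+-identityˡ _))

  ·-congˡ : (A : Mat) {B C : Mat} → (∀ u v → B u v ≈ C u v) → ∀ s t → (A · B) s t ≈ (A · C) s t
  ·-congˡ A B≈C s t = +-cong (*-congˡ (B≈C false t)) (*-congˡ (B≈C true t))

  sumFin-weighted≈profile-· : {n : ℕ} (p : SelPair (Fin n)) (B : Mat) (s t : Bool) →
    sumFin n (λ i → w p s i * B (α p s i) t) ≈ (profile (sumFin n) p · B) s t
  sumFin-weighted≈profile-· {n} p B s t = begin
    sumFin n (λ i → w p s i * B (α p s i) t)
      ≈⟨ sumFin-cong n (λ i → *-split-on-Bool (α p s i) (w p s i) (λ u → B u t)) ⟩
    sumFin n (λ i → w₀ i * B false t + w₁ i * B true t)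
      ≈⟨ sumFin-distrib-+ n _ _ ⟩
    sumFin n (λ i → w₀ i * B false t) + sumFin n (λ i → w₁ i * B true t)
      ≈⟨ +-cong (*-distribʳ-sumFin n _ w₀) (*-distribʳ-sumFin n _ w₁) ⟨
    sumFin n w₀ * B false t + sumFin n w₁ * B true t
      ∎
    where
    w₀ w₁ : Fin n → Carrier
    w₀ i = if does (α p s i ≟B false) then w p s i else 0#
    w₁ i = if does (α p s i ≟B true) then w p s i else 0#

  profileComp-∷ : {n : ℕ} {ns : List ℕ} (p : SelPair (Fin n)) (ps : Pairs ns) (s t : Bool) →
    profileComp (p ∷ ps) s t ≈ sumFin n (λ i → w p s i * profileComp ps (α p s i) t)
  profileComp-∷ {n} {ns} p ps s t = sumFin-cong n λ i →
    trans (sumIdx-cong ns (λ j → if-*ˡ _ _ _)) (sym (*-distribˡ-sumIdx ns _ _))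

  profileComp≈prodProfiles : (n : ℕ) (ns : List ℕ) (ps : Pairs (n ∷ ns)) (s t : Bool) →
    profileComp ps s t ≈ prodProfiles ps s t
  profileComp≈prodProfiles n []       (p ∷ [])     s t = sumFin-cong n (λ i → if-*-identityʳ _ _)
  profileComp≈prodProfiles n (m ∷ ns) (p ∷ q ∷ ps) s t = begin
    profileComp (p ∷ q ∷ ps) s t
      ≈⟨ profileComp-∷ p (q ∷ ps) s t ⟩
    sumFin n (λ i → w p s i * profileComp (q ∷ ps) (α p s i) t)
      ≈⟨ sumFin-weighted≈profile-· p (profileComp (q ∷ ps)) s t ⟩
    (M₁ · profileComp (q ∷ ps)) s t
      ≈⟨ ·-congˡ M₁ (profileComp≈prodProfiles m ns (q ∷ ps)) s t ⟩
    (M₁ · prodProfiles (q ∷ ps)) s t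
      ∎
    where
    M₁ : Mat
    M₁ = profile (sumFin n) p

mainTheorem9 : {c ℓ : Level} (R : CommutativeSemiring c ℓ) →
    (n : ℕ) (ns : List ℕ) (ps : AW.Pairs R (n ∷ ns)) (s t : Bool) →
    CommutativeSemiring._≈_ R (AW.profileComp R ps s t) (AW.prodProfiles R ps s t)
mainTheorem9 R = Composition.profileComp≈prodProfiles R
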